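{- Let $T=(V,A)$ be a tournament and $k$ a positive integer such that $T$ has a feedback arc set of at most $k$ arcs. Suppose moreover that: (1) every vertex of $T$ lies in some directed triangle; (2) no arc of $T$ belongs to more than $k$ distinct directed triangles; (3) for every maximal transitive module $V_m$ of $T$, with $p=|V_m|$, $I$ the set of vertices outside $V_m$ that are in-neighbours of the vertices of $V_m$, $O$ the set of vertices outside $V_m$ that are out-neighbours of the vertices of $V_m$, and $Z$ the set of arcs $uv$ of $T$ with $u\in O$ and $v \in I$, we have $|Z| \ge p$. Then $T$ has $O(k\sqrt{k})$ vertices.
   Context: A tournament is a digraph with exactly one arc between every pair of distinct vertices. A feedback arc set is a set of arcs whose removal leaves an acyclic digraph. For a vertex $v$, $N^+(v)$ is its set of out-neighbours. A set $M\subseteq V$ is a module if $N^+(u)\setminus M = N^+(v)\setminus M$ for all $u,v\in M$ (so every vertex outside $M$ is either an in-neighbour of all vertices of $M$ or an out-neighbour of all of them). A transitive module is a module inducing an acyclic (transitive) subtournament; a maximal transitive module is one that is maximal under inclusion among transitive modules. -}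

module Defs where

open import Data.Nat using (ℕ; _≤_; _≥_)
open import Data.Bool using (Bool; true; false; not; _∧_; _∨_)
open import Data.Fin using (Fin)
open import Data.List using (List; length; filterᵇ; allFin; cartesianProduct)
open import Data.Bool.ListAction using (all)
open import Data.List.Membership.Propositional using (_∉_)
open import Data.Product using (_×_; _,_; ∃-syntax)
open import Relation.Binary.PropositionalEquality using (_≡_; _≢_)
open import Relation.Binary.Construct.Closure.Transitive using (TransClosure)
open import Relation.Nullary using (¬_)

-- A digraph on vertex set Fin n is given by a Boolean adjacency function:
-- A u v ≡ true means there is an arc u → v.
Digraph : ℕ → Set
Digraph n = Fin n → Fin n → Bool

IsTournament : ∀ {n} → Digraph n → Set
IsTournament {n} A =
  ((u : Fin n) → A u u ≡ false) ×
  ((u v : Fin n) → u ≢ v → A u v ≡ not (A v u))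

Acyclic : ∀ {n} → (Fin n → Fin n → Set) → Set
Acyclic {n} R = (x : Fin n) → ¬ TransClosure R x x

IsFeedbackArcSet : ∀ {n} → Digraph n → List (Fin n × Fin n) → Set
IsFeedbackArcSet {n} A F =
  ((u v : Fin n) → (u , v) Data.List.Membership.Propositional.∈ F → A u v ≡ true) ×
  Acyclic (λ u v → (A u v ≡ true) × ((u , v) ∉ F))

HasFASAtMost : ∀ {n} → Digraph n → ℕ → Set
HasFASAtMost A k = ∃[ F ] (IsFeedbackArcSet A F × length F ≤ k)

InTriangle : ∀ {n} → Digraph n → Fin n → Set
InTriangle A v = ∃[ a ] ∃[ b ] ((A v a ≡ true) × (A a b ≡ true) × (A b v ≡ true))

trianglesOnArc : ∀ {n} → Digraph n → Fin n → Fin n → ℕ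
trianglesOnArc {n} A u v = length (filterᵇ (λ w → A v w ∧ A w u) (allFin n))

VSet : ℕ → Set
VSet n = Fin n → Bool

size : ∀ {n} → VSet n → ℕ
size {n} M = length (filterᵇ M (allFin n))

IsModule : ∀ {n} → Digraph n → VSet n → Set
IsModule {n} A M = (u v w : Fin n) → M u ≡ true → M v ≡ true → M w ≡ false → A u w ≡ A v w

IsTransitiveModule : ∀ {n} → Digraph n → VSet n → Set
IsTransitiveModule A M =
  IsModule A M × Acyclic (λ u v → (M u ≡ true) × (M v ≡ true) × (A u v ≡ true))

_⊆ᵛ_ : ∀ {n} → VSet n → VSet n → Set
_⊆ᵛ_ {n} M M' = (u : Fin n) → M u ≡ true → M' u ≡ true

IsMaximalTransitiveModule : ∀ {n} → Digraph n → VSet n → Set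
IsMaximalTransitiveModule {n} A M =
  IsTransitiveModule A M ×
  ((M' : VSet n) → IsTransitiveModule A M' → M ⊆ᵛ M' → M' ⊆ᵛ M)

inSet : ∀ {n} → Digraph n → VSet n → VSet n
inSet {n} A M w = not (M w) ∧ all (λ u → not (M u) ∨ A w u) (allFin n)

outSet : ∀ {n} → Digraph n → VSet n → VSet n
outSet {n} A M w = not (M w) ∧ all (λ u → not (M u) ∨ A u w) (allFin n)

backArcCount : ∀ {n} → Digraph n → VSet n → ℕ
backArcCount {n} A M =
  length (filterᵇ (λ { (u , v) → outSet A M u ∧ inSet A M v ∧ A u v })
                  (cartesianProduct (allFin n) (allFin n)))

module Submission where

-- A tournament with a feedback arc set F of at most k arcs, in which no arc lies on
-- more than k directed triangles and every maximal transitive module M has at least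
-- |M| back arcs, has n² ≤ 14k³ (so n = O(k√k)).
--
-- Rank the vertices so that every arc outside F goes up in rank (the arcs
-- outside F form an acyclic digraph).  At a vertex x that is not an endpoint of F
-- ("clean"), every arc is ranked, so the orientation of these arcs is read off the
-- ranks.  Cutting the rank order of the clean vertices at the ≤ 2k endpoints of F
-- gives at most 2k + 1 blocks, and each block is a transitive module.  Extend the
-- block of a clean x to a maximal transitive module M: each back arc u → v of M
-- closes the triangle x → u → v → x, and u → v must lie in F.  Hence |block| ≤ the
-- number of triangles through x on arcs of F, and summing over clean x gives
-- ∑ |block|² ≤ k·k.  Cauchy–Schwarz over the ≤ 2k + 1 blocks bounds the number c of
-- clean vertices by c² ≤ (2k + 1)k², and n ≤ 2k + c then yields n² ≤ 14k³.

open import Defs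
open import Data.Nat using (ℕ; _≤_; _≥_; _*_; _>_)
open import Data.Fin using (Fin)
open import Data.Product using (∃-syntax)
open import Data.Bool using (true)
open import Relation.Binary.PropositionalEquality using (_≡_)

open import Level using (0ℓ)
open import Data.Nat using (zero; suc; _+_; _<_; z≤n; s≤s; _≡ᵇ_; _<?_; _≤?_)
open import Data.Nat.Properties
open import Data.Nat.Tactic.RingSolver using (solve-∀)
open import Data.Bool using (Bool; false; not; _∧_; _∨_; T)
open import Data.Bool.Properties using (∧-conicalˡ; ∧-conicalʳ; T-≡; ⇔→≡)
open import Data.Bool.ListAction using (all)
open import Data.Fin.Properties using (sequence) renaming (_≟_ to _≟ᶠ_)
open import Data.List using (List; []; _∷_; length; filterᵇ; allFin; cartesianProduct; downFrom)
open import Data.List.Properties using (length-tabulate; length-downFrom; length-filter)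
open import Data.List.Membership.Propositional using (_∈_; _∉_)
open import Data.List.Membership.Propositional.Properties using (∈-allFin)
import Data.List.Membership.DecPropositional as DecMembership
open import Data.List.Relation.Unary.Any using (here; there)
open import Data.List.Relation.Unary.All using (All; []; _∷_)
import Data.List.Relation.Unary.All as All
open import Data.List.Relation.Unary.All.Properties using (all⁺)
open import Data.List.Relation.Unary.AllPairs using ([]; _∷_)
open import Data.List.Relation.Unary.Unique.Propositional using (Unique)
open import Data.List.Relation.Unary.Unique.Propositional.Properties using (allFin⁺; cartesianProduct⁺)
open import Data.Product using (Σ; _×_; _,_; proj₁; proj₂)
open import Data.Product.Properties using (≡-dec)
open import Data.Empty using (⊥)
open import Data.Sum using (_⊎_; inj₁; inj₂)
open import Effect.Monad using (RawMonad)
open import Function using (_∘_; _$_)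
open import Function.Bundles using (Equivalence; mk⇔)
open import Relation.Nullary using (¬_; Dec; yes; no)
open import Relation.Nullary.Decidable using (⌊_⌋; decidable-stable)
open import Relation.Nullary.Decidable.Core using (T?; ¬¬-excluded-middle)
open import Relation.Nullary.Negation using (¬¬-Monad; contradiction)
open import Relation.Binary.Definitions using (DecidableEquality)
open import Relation.Binary.Construct.Closure.Transitive using (TransClosure; [_]; _∷_; _∷ʳ_)
open import Relation.Binary.PropositionalEquality
  using (_≢_; refl; sym; trans; cong; cong₂; subst; subst₂; module ≡-Reasoning)

private variable
  X Y : Set

∑ : List X → (X → ℕ) → ℕ
∑ []       f = 0
∑ (x ∷ xs) f = f x + ∑ xs f

ind : Bool → ℕ
ind true  = 1
ind false = 0

T⇒≡true : ∀ {b} → T b → b ≡ true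
T⇒≡true = Equivalence.to T-≡

≡true⇒T : ∀ {b} → b ≡ true → T b
≡true⇒T = Equivalence.from T-≡

ind-∧ : ∀ a b → ind (a ∧ b) ≡ ind a * ind b
ind-∧ true  b = sym (+-identityʳ (ind b))
ind-∧ false b = refl

ind-not : ∀ b → ind b + ind (not b) ≡ 1
ind-not true  = refl
ind-not false = refl

count : (X → Bool) → List X → ℕ
count p xs = length (filterᵇ p xs)

count≡∑ : ∀ (p : X → Bool) xs → count p xs ≡ ∑ xs (ind ∘ p)
count≡∑ p []       = refl
count≡∑ p (x ∷ xs) with p x
... | true  = cong suc (count≡∑ p xs)
... | false = count≡∑ p xs

module _ {f g : X → ℕ} where

  ∑-cong : (∀ x → f x ≡ g x) → ∀ xs → ∑ xs f ≡ ∑ xs g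
  ∑-cong f≡g []       = refl
  ∑-cong f≡g (x ∷ xs) = cong₂ _+_ (f≡g x) (∑-cong f≡g xs)

  ∑-mono-∈ : ∀ xs → (∀ {x} → x ∈ xs → f x ≤ g x) → ∑ xs f ≤ ∑ xs g
  ∑-mono-∈ []       f≤g = z≤n
  ∑-mono-∈ (x ∷ xs) f≤g = +-mono-≤ (f≤g (here refl)) (∑-mono-∈ xs (f≤g ∘ there))

  ∑-mono : (∀ x → f x ≤ g x) → ∀ xs → ∑ xs f ≤ ∑ xs g
  ∑-mono f≤g xs = ∑-mono-∈ xs (λ {x} _ → f≤g x)

  ∑-mono-< : (∀ x → f x ≤ g x) → ∀ {y} xs → y ∈ xs → f y < g y → ∑ xs f < ∑ xs g
  ∑-mono-< f≤g (x ∷ xs) (here refl) fy<gy = +-mono-<-≤ fy<gy (∑-mono f≤g xs)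
  ∑-mono-< f≤g (x ∷ xs) (there y∈xs) fy<gy = +-mono-≤-< (f≤g x) (∑-mono-< f≤g xs y∈xs fy<gy)

∑-const : ∀ c (xs : List X) → ∑ xs (λ _ → c) ≡ length xs * c
∑-const c []       = refl
∑-const c (x ∷ xs) = cong (c +_) (∑-const c xs)

∑-zero : ∀ (xs : List X) → ∑ xs (λ _ → 0) ≡ 0
∑-zero xs = trans (∑-const 0 xs) (*-zeroʳ (length xs))

∑-+ : ∀ (f g : X → ℕ) xs → ∑ xs (λ x → f x + g x) ≡ ∑ xs f + ∑ xs g
∑-+ f g []       = refl
∑-+ f g (x ∷ xs) = trans (cong (f x + g x +_) (∑-+ f g xs)) (interchange (f x) (g x) (∑ xs f) (∑ xs g))
  where
  interchange : ∀ a b c d → a + b + (c + d) ≡ a + c + (b + d)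
  interchange = solve-∀

∑-*ʳ : ∀ (f : X → ℕ) c xs → ∑ xs f * c ≡ ∑ xs (λ x → f x * c)
∑-*ʳ f c []       = refl
∑-*ʳ f c (x ∷ xs) = trans (*-distribʳ-+ c (f x) (∑ xs f)) (cong (f x * c +_) (∑-*ʳ f c xs))

∑-swap : ∀ (f : X → Y → ℕ) xs ys → ∑ xs (λ x → ∑ ys (f x)) ≡ ∑ ys (λ y → ∑ xs (λ x → f x y))
∑-swap f []       ys = sym (∑-zero ys)
∑-swap f (x ∷ xs) ys =
  trans (cong (∑ ys (f x) +_) (∑-swap f xs ys)) (sym (∑-+ (f x) (λ y → ∑ xs (λ x′ → f x′ y)) ys))

∑-ind≤length : ∀ (p : X → Bool) xs → ∑ xs (ind ∘ p) ≤ length xs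
∑-ind≤length p xs = subst (_≤ length xs) (count≡∑ p xs) (length-filter (T? ∘ p) xs)

count-mono : ∀ (p q : X → Bool) → (∀ x → p x ≡ true → q x ≡ true) → ∀ xs → count p xs ≤ count q xs
count-mono p q p⇒q xs = subst₂ _≤_ (sym (count≡∑ p xs)) (sym (count≡∑ q xs)) (∑-mono pointwise xs)
  where
  pointwise : ∀ x → ind (p x) ≤ ind (q x)
  pointwise x with p x in px
  ... | true  rewrite p⇒q x px = ≤-refl
  ... | false = z≤n

≡ᵇ-true : ∀ i j → (i ≡ᵇ j) ≡ true → i ≡ j
≡ᵇ-true i j i≡ᵇj = ≡ᵇ⇒≡ i j (≡true⇒T i≡ᵇj)

≡ᵇ-false : ∀ i j → (i ≡ᵇ j) ≡ false → i ≢ j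
≡ᵇ-false i j i≢ᵇj i≡j = subst T i≢ᵇj (≡⇒≡ᵇ i j i≡j)

module _ (g : ℕ → ℕ) where

  δ-sum-above : ∀ i m → m ≤ i → ∑ (downFrom m) (λ j → ind (i ≡ᵇ j) * g j) ≡ 0
  δ-sum-above i zero    m≤i = refl
  δ-sum-above i (suc m) m<i with i ≡ᵇ m in i≡ᵇm
  ... | true  = contradiction (≡ᵇ-true i m i≡ᵇm) (>⇒≢ m<i)
  ... | false = δ-sum-above i m (<⇒≤ m<i)

  δ-sum : ∀ i m → i < m → ∑ (downFrom m) (λ j → ind (i ≡ᵇ j) * g j) ≡ g i
  δ-sum i (suc m) i<m with i ≡ᵇ m in i≡ᵇm
  ... | true  with refl ← ≡ᵇ-true i m i≡ᵇm =
    trans (cong (g i + 0 +_) (δ-sum-above i i ≤-refl)) (trans (+-identityʳ _) (+-identityʳ _))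
  ... | false = δ-sum i m (≤∧≢⇒< (≤-pred i<m) (≡ᵇ-false i m i≡ᵇm))

∑-fibres : ∀ (c : X → Bool) (label : X → ℕ) (g : ℕ → ℕ) m xs → (∀ x → label x < m) →
           ∑ xs (λ x → ind (c x) * g (label x))
           ≡ ∑ (downFrom m) (λ j → count (λ x → c x ∧ (label x ≡ᵇ j)) xs * g j)
∑-fibres c label g m xs label<m = begin
  ∑ xs (λ x → ind (c x) * g (label x))
    ≡⟨ ∑-cong (λ x → sym (δ-sum-∧ (c x) (label x) (label<m x))) xs ⟩
  ∑ xs (λ x → ∑ (downFrom m) (λ j → ind (c x ∧ (label x ≡ᵇ j)) * g j))
    ≡⟨ ∑-swap (λ x j → ind (c x ∧ (label x ≡ᵇ j)) * g j) xs (downFrom m) ⟩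
  ∑ (downFrom m) (λ j → ∑ xs (λ x → ind (c x ∧ (label x ≡ᵇ j)) * g j))
    ≡⟨ ∑-cong (λ j → sym (trans (cong (_* g j) (count≡∑ _ xs)) (∑-*ʳ _ (g j) xs))) (downFrom m) ⟩
  ∑ (downFrom m) (λ j → count (λ x → c x ∧ (label x ≡ᵇ j)) xs * g j) ∎
  where
  open ≡-Reasoning
  δ-sum-∧ : ∀ b i → i < m → ∑ (downFrom m) (λ j → ind (b ∧ (i ≡ᵇ j)) * g j) ≡ ind b * g i
  δ-sum-∧ true  i i<m = trans (δ-sum g i m i<m) (sym (+-identityʳ (g i)))
  δ-sum-∧ false i i<m = ∑-zero (downFrom m)

module _ {X : Set} (_≟X_ : DecidableEquality X) where

  open import Data.List.Membership.DecPropositional _≟X_ using (_∈?_)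

  private
    ∑-none : ∀ (g : X → ℕ) e (xs : List X) → All (λ x → ¬ x ≡ e) xs → ∑ xs (λ x → ind ⌊ x ≟X e ⌋ * g x) ≡ 0
    ∑-none g e []       []            = refl
    ∑-none g e (x ∷ xs) (x≢e ∷ xs≢e) with x ≟X e
    ... | yes x≡e = contradiction x≡e x≢e
    ... | no _    = ∑-none g e xs xs≢e

    ∑-single : ∀ (g : X → ℕ) e (xs : List X) → Unique xs → ∑ xs (λ x → ind ⌊ x ≟X e ⌋ * g x) ≤ g e
    ∑-single g e []       []            = z≤n
    ∑-single g e (x ∷ xs) (x∉xs ∷ uniq) with x ≟X e
    ... | yes refl = ≤-reflexive (trans (cong (g x + 0 +_) (∑-none g x xs (All.map (λ x≢y y≡x → x≢y (sym y≡x)) x∉xs)))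
                                        (trans (+-identityʳ _) (+-identityʳ _)))
    ... | no _     = ∑-single g e xs uniq

  ∑-∈-≤ : ∀ (g : X → ℕ) xs → Unique xs → ∀ es → ∑ xs (λ x → ind ⌊ x ∈? es ⌋ * g x) ≤ ∑ es g
  ∑-∈-≤ g xs uniq []       = ≤-reflexive (∑-zero xs)
  ∑-∈-≤ g xs uniq (e ∷ es) = begin
    ∑ xs (λ x → ind ⌊ x ∈? (e ∷ es) ⌋ * g x)
      ≤⟨ ∑-mono split xs ⟩
    ∑ xs (λ x → ind ⌊ x ≟X e ⌋ * g x + ind ⌊ x ∈? es ⌋ * g x)
      ≡⟨ ∑-+ _ _ xs ⟩
    ∑ xs (λ x → ind ⌊ x ≟X e ⌋ * g x) + ∑ xs (λ x → ind ⌊ x ∈? es ⌋ * g x)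
      ≤⟨ +-mono-≤ (∑-single g e xs uniq) (∑-∈-≤ g xs uniq es) ⟩
    g e + ∑ es g ∎
    where
    open ≤-Reasoning
    split : ∀ x → ind ⌊ x ∈? (e ∷ es) ⌋ * g x ≤ ind ⌊ x ≟X e ⌋ * g x + ind ⌊ x ∈? es ⌋ * g x
    split x with x ≟X e | x ∈? es
    ... | yes _ | _     = m≤m+n _ _
    ... | no _  | yes _ = ≤-refl
    ... | no _  | no _  = ≤-refl

2ab≤a²+b²-ordered : ∀ a b → a ≤ b → 2 * (a * b) ≤ a * a + b * b
2ab≤a²+b²-ordered a b a≤b with m≤n⇒∃[o]m+o≡n a≤b
... | d , refl = ≤-trans (m≤m+n _ (d * d)) (≤-reflexive (expand a d))
  where
  expand : ∀ a d → 2 * (a * (a + d)) + d * d ≡ a * a + (a + d) * (a + d)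
  expand = solve-∀

2ab≤a²+b² : ∀ a b → 2 * (a * b) ≤ a * a + b * b
2ab≤a²+b² a b with ≤-total a b
... | inj₁ a≤b = 2ab≤a²+b²-ordered a b a≤b
... | inj₂ b≤a = subst₂ _≤_ (cong (2 *_) (*-comm b a)) (+-comm (b * b) (a * a)) (2ab≤a²+b²-ordered b a b≤a)

module _ (f : X → ℕ) where

  private
    ∑² : List X → ℕ
    ∑² xs = ∑ xs (λ x → f x * f x)

    cross-term : ∀ a xs → 2 * (a * ∑ xs f) ≤ length xs * (a * a) + ∑² xs
    cross-term a []       = ≤-reflexive (cong (2 *_) (*-zeroʳ a))
    cross-term a (x ∷ xs) = begin
      2 * (a * (f x + ∑ xs f))                      ≡⟨ distrib a (f x) (∑ xs f) ⟩
      2 * (a * f x) + 2 * (a * ∑ xs f)              ≤⟨ +-mono-≤ (2ab≤a²+b² a (f x)) (cross-term a xs) ⟩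
      (a * a + f x * f x) + (length xs * (a * a) + ∑² xs) ≡⟨ regroup (a * a) (f x * f x) (length xs * (a * a)) (∑² xs) ⟩
      (a * a + length xs * (a * a)) + (f x * f x + ∑² xs) ∎
      where
      open ≤-Reasoning
      distrib : ∀ a b c → 2 * (a * (b + c)) ≡ 2 * (a * b) + 2 * (a * c)
      distrib = solve-∀
      regroup : ∀ p q r s → (p + q) + (r + s) ≡ (p + r) + (q + s)
      regroup = solve-∀

  cauchy-schwarz : ∀ xs → ∑ xs f * ∑ xs f ≤ length xs * ∑² xs
  cauchy-schwarz []       = z≤n
  cauchy-schwarz (x ∷ xs) = begin
    (a + s) * (a + s)                              ≡⟨ square a s ⟩
    a * a + 2 * (a * s) + s * s                    ≤⟨ +-mono-≤ (+-monoʳ-≤ (a * a) (cross-term a xs)) (cauchy-schwarz xs) ⟩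
    a * a + (l * (a * a) + ∑² xs) + l * ∑² xs      ≡⟨ collect a l (∑² xs) ⟩
    suc l * (a * a + ∑² xs) ∎
    where
    open ≤-Reasoning
    a = f x
    s = ∑ xs f
    l = length xs
    square : ∀ a s → (a + s) * (a + s) ≡ a * a + 2 * (a * s) + s * s
    square = solve-∀
    collect : ∀ a l q → a * a + (l * (a * a) + q) + l * q ≡ suc l * (a * a + q)
    collect = solve-∀

-- Classical steps are carried out in the double-negation monad; this is harmless
-- because the conclusion of the theorem is a decidable inequality.
open RawMonad (¬¬-Monad {0ℓ}) using (pure; _>>=_; rawApplicative)

all-at : ∀ {n} (p : Fin n → Bool) → all p (allFin n) ≡ true → ∀ y → p y ≡ true
all-at {n} p all-p y = T⇒≡true (All.lookup (all⁺ p (allFin n) (≡true⇒T all-p)) (∈-allFin y))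

Ranking : ∀ {n} → (Fin n → Fin n → Set) → Set
Ranking {n} R = Σ (Fin n → ℕ) λ r → ∀ {x y} → R x y → r x < r y

ranking-walk : ∀ {n} {R : Fin n → Fin n → Set} ((r , r-mono) : Ranking R) →
               ∀ {x y} → TransClosure R x y → r x < r y
ranking-walk (r , r-mono) [ xRy ]     = r-mono xRy
ranking-walk (r , r-mono) (xRz ∷ z⁺y) = <-trans (r-mono xRz) (ranking-walk (r , r-mono) z⁺y)

-- Conversely (classically) an acyclic relation on Fin n is ranked by
-- rank x = number of vertices from which x is reachable.
acyclic⇒ranking : ∀ {n} (R : Fin n → Fin n → Set) → Acyclic R → ¬ ¬ Ranking R
acyclic⇒ranking {n} R acyclic = do
  reach? ← sequence rawApplicative (λ y → sequence rawApplicative (λ x → ¬¬-excluded-middle))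
  pure (rank reach? , λ {x} {y} → rank-mono reach? {x} {y})
  where
  Reach? : Set
  Reach? = (y x : Fin n) → Dec (TransClosure R y x)

  rank : Reach? → Fin n → ℕ
  rank reach? x = ∑ (allFin n) (λ y → ind ⌊ reach? y x ⌋)

  rank-mono : (reach? : Reach?) → ∀ {x y} → R x y → rank reach? x < rank reach? y
  rank-mono reach? {x} {y} xRy = ∑-mono-< reachers-of-y (allFin n) (∈-allFin x) x-reaches-only-y
    where
    reachers-of-y : ∀ z → ind ⌊ reach? z x ⌋ ≤ ind ⌊ reach? z y ⌋
    reachers-of-y z with reach? z x | reach? z y
    ... | yes _     | yes _    = ≤-refl
    ... | yes z⁺x   | no ¬z⁺y  = contradiction (z⁺x ∷ʳ xRy) ¬z⁺y
    ... | no _      | _        = z≤n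
    x-reaches-only-y : ind ⌊ reach? x x ⌋ < ind ⌊ reach? x y ⌋
    x-reaches-only-y with reach? x x | reach? x y
    ... | yes x⁺x | _       = contradiction x⁺x (acyclic x)
    ... | no _    | yes _   = s≤s z≤n
    ... | no _    | no ¬x⁺y = contradiction [ xRy ] ¬x⁺y

size-≤ : ∀ {n} (M : VSet n) → size M ≤ n
size-≤ {n} M = subst (size M ≤_) (length-tabulate (λ x → x)) (length-filter (T? ∘ M) (allFin n))

size-mono : ∀ {n} {M M′ : VSet n} → M ⊆ᵛ M′ → size M ≤ size M′
size-mono {n} {M} {M′} M⊆M′ = count-mono M M′ M⊆M′ (allFin n)

size-mono-< : ∀ {n} {M M′ : VSet n} {u} → M ⊆ᵛ M′ → M′ u ≡ true → M u ≡ false → size M < size M′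
size-mono-< {n} {M} {M′} {u} M⊆M′ M′u Mu =
  subst₂ _<_ (sym (count≡∑ M (allFin n))) (sym (count≡∑ M′ (allFin n)))
    (∑-mono-< pointwise (allFin n) (∈-allFin u) (subst₂ (λ a b → ind a < ind b) (sym Mu) (sym M′u) (s≤s z≤n)))
  where
  pointwise : ∀ x → ind (M x) ≤ ind (M′ x)
  pointwise x with M x in Mx
  ... | true  rewrite M⊆M′ x Mx = ≤-refl
  ... | false = z≤n

IsMaximal : ∀ {n} → (VSet n → Set) → VSet n → Set
IsMaximal {n} P M = P M × ((M′ : VSet n) → P M′ → M ⊆ᵛ M′ → M′ ⊆ᵛ M)

-- Classically every vertex set with property P lies in a maximal one: enlarge it
-- while possible; its size strictly grows and is bounded by n.
maximal-extension : ∀ {n} (P : VSet n → Set) (M : VSet n) → P M →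
                    ¬ ¬ (Σ (VSet n) λ M′ → IsMaximal P M′ × M ⊆ᵛ M′)
maximal-extension {n} P M₀ PM₀ = grow n M₀ PM₀ (m≤n+m n (size M₀))
  where
  StrictExtension : VSet n → Set
  StrictExtension M = Σ (VSet n) λ M′ → P M′ × M ⊆ᵛ M′ × Σ (Fin n) λ u → M′ u ≡ true × M u ≡ false

  strict-extension : ∀ M → ¬ ((M′ : VSet n) → P M′ → M ⊆ᵛ M′ → M′ ⊆ᵛ M) → ¬ ¬ StrictExtension M
  strict-extension M not-maximal no-extension = not-maximal contained
    where
    contained : (M′ : VSet n) → P M′ → M ⊆ᵛ M′ → M′ ⊆ᵛ M
    contained M′ PM′ M⊆M′ u M′u with M u in Mu
    ... | true  = refl
    ... | false = contradiction (M′ , PM′ , M⊆M′ , u , M′u , Mu) no-extension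

  Extension : VSet n → Set
  Extension M = Σ (VSet n) λ M′ → IsMaximal P M′ × M ⊆ᵛ M′

  grow : ∀ fuel M → P M → n ≤ size M + fuel → ¬ ¬ Extension M
  grow fuel M PM bound = ¬¬-excluded-middle >>= decide
    where
    -- The size bound rules out a strict extension when the fuel is exhausted.
    enlarge : ∀ fuel M′ → P M′ → M ⊆ᵛ M′ → size M < size M′ → n ≤ size M + fuel → ¬ ¬ Extension M
    enlarge zero       M′ PM′ M⊆M′ M<M′ bound =
      contradiction (≤-trans bound (≤-reflexive (+-identityʳ (size M)))) (<⇒≱ (<-≤-trans M<M′ (size-≤ M′)))
    enlarge (suc fuel) M′ PM′ M⊆M′ M<M′ bound = do
      (M″ , maximal , M′⊆M″) ← grow fuel M′ PM′ (≤-trans bound (≤-trans (≤-reflexive (+-suc (size M) fuel)) (+-monoˡ-≤ fuel M<M′)))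
      pure (M″ , maximal , λ u Mu → M′⊆M″ u (M⊆M′ u Mu))

    decide : Dec ((M′ : VSet n) → P M′ → M ⊆ᵛ M′ → M′ ⊆ᵛ M) → ¬ ¬ Extension M
    decide (yes maximal)    = pure (M , (PM , maximal) , λ _ Mu → Mu)
    decide (no not-maximal) = do
      (M′ , PM′ , M⊆M′ , u , M′u , Mu) ← strict-extension M not-maximal
      enlarge fuel M′ PM′ M⊆M′ (size-mono-< M⊆M′ M′u Mu) bound

private
  or-not : ∀ {a b} → a ≡ true → (not a ∨ b) ≡ true → b ≡ true
  or-not refl b≡true = b≡true

outSet-arc : ∀ {n} (A : Digraph n) (M : VSet n) {x u} → outSet A M u ≡ true → M x ≡ true → A x u ≡ true
outSet-arc {n} A M {x} {u} u∈O Mx =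
  or-not Mx (all-at (λ y → not (M y) ∨ A y u) (∧-conicalʳ (not (M u)) _ u∈O) x)

inSet-arc : ∀ {n} (A : Digraph n) (M : VSet n) {x v} → inSet A M v ≡ true → M x ≡ true → A v x ≡ true
inSet-arc {n} A M {x} {v} v∈I Mx =
  or-not Mx (all-at (λ y → not (M y) ∨ A v y) (∧-conicalʳ (not (M v)) _ v∈I) x)

endpoints : ∀ {n} → List (Fin n × Fin n) → List (Fin n)
endpoints []             = []
endpoints ((u , v) ∷ G) = u ∷ v ∷ endpoints G

length-endpoints : ∀ {n} (G : List (Fin n × Fin n)) → length (endpoints G) ≡ 2 * length G
length-endpoints []            = refl
length-endpoints ((u , v) ∷ G) = trans (cong (2 +_) (length-endpoints G)) (sym (*-suc 2 (length G)))

endpoints-∈ : ∀ {n} {u v : Fin n} G → (u , v) ∈ G → u ∈ endpoints G × v ∈ endpoints G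
endpoints-∈ ((u , v) ∷ G) (here refl) = here refl , there (here refl)
endpoints-∈ ((a , b) ∷ G) (there uv∈G) with endpoints-∈ G uv∈G
... | u∈ , v∈ = there (there u∈) , there (there v∈)

-- A vertex is clean if it is not an endpoint of F: every arc at a clean vertex is
-- ranked, so the rank alone decides the orientation of these arcs.  Cutting the
-- clean vertices, ordered by rank, at the |endpoints F| dirty vertices yields at
-- most |endpoints F| + 1 blocks, each of them a transitive module.
module Blocks {n} (A : Digraph n) (tournament : IsTournament A) (F : List (Fin n × Fin n))
              (r : Fin n → ℕ) (r-mono : ∀ {x y} → A x y ≡ true → (x , y) ∉ F → r x < r y) where

  open DecMembership (_≟ᶠ_ {n}) using (_∈?_)

  dirty : List (Fin n)
  dirty = endpoints F

  clean : VSet n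
  clean x = not (⌊ x ∈? dirty ⌋)

  clean⇒∉ : ∀ {x} → clean x ≡ true → x ∉ dirty
  clean⇒∉ {x} cx x∈ with x ∈? dirty
  clean⇒∉ {x} () x∈ | yes _
  clean⇒∉ {x} cx x∈ | no x∉ = x∉ x∈

  arc-from-clean : ∀ {x w} → clean x ≡ true → A x w ≡ true → r x < r w
  arc-from-clean cx xw = r-mono xw (clean⇒∉ cx ∘ proj₁ ∘ endpoints-∈ F)

  arc-to-clean : ∀ {x w} → clean x ≡ true → A w x ≡ true → r w < r x
  arc-to-clean cx wx = r-mono wx (clean⇒∉ cx ∘ proj₂ ∘ endpoints-∈ F)

  reverse-arc : ∀ {x w} → x ≢ w → A x w ≡ false → A w x ≡ true
  reverse-arc {x} {w} x≢w xw = trans (proj₂ tournament w x (x≢w ∘ sym)) (cong not xw)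

  rank⇒arc : ∀ {x w} → clean x ≡ true → x ≢ w → r x < r w → A x w ≡ true
  rank⇒arc {x} {w} cx x≢w rx<rw with A x w in xw
  ... | true  = refl
  ... | false = contradiction (arc-to-clean cx (reverse-arc x≢w xw)) (<⇒≯ rx<rw)

  rank-distinct : ∀ {x w} → clean x ≡ true → x ≢ w → r w ≢ r x
  rank-distinct {x} {w} cx x≢w rw≡rx with A x w in xw
  ... | true  = <-irrefl (sym rw≡rx) (arc-from-clean cx xw)
  ... | false = <-irrefl rw≡rx (arc-to-clean cx (reverse-arc x≢w xw))

  key : Fin n → ℕ
  key x = ∑ dirty (λ e → ind ⌊ r e <? r x ⌋)

  key<blocks : ∀ x → key x < suc (length dirty)
  key<blocks x = s≤s (∑-ind≤length (λ e → ⌊ r e <? r x ⌋) dirty)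

  private
    below-mono : ∀ {x y} → r x ≤ r y → ∀ e → ind ⌊ r e <? r x ⌋ ≤ ind ⌊ r e <? r y ⌋
    below-mono {x} {y} rx≤ry e with r e <? r x | r e <? r y
    ... | yes _     | yes _     = ≤-refl
    ... | yes re<rx | no re≮ry  = contradiction (<-≤-trans re<rx rx≤ry) re≮ry
    ... | no _      | _         = z≤n

  key-mono : ∀ {x y} → r x ≤ r y → key x ≤ key y
  key-mono rx≤ry = ∑-mono (below-mono rx≤ry) dirty

  key-mono-< : ∀ {x y e} → e ∈ dirty → r x < r e → r e < r y → key x < key y
  key-mono-< {x} {y} {e} e∈ rx<re re<ry =
    ∑-mono-< (below-mono (<⇒≤ (<-trans rx<re re<ry))) dirty e∈ e-separates
    where
    e-separates : ind ⌊ r e <? r x ⌋ < ind ⌊ r e <? r y ⌋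
    e-separates with r e <? r x | r e <? r y
    ... | yes re<rx | _        = contradiction re<rx (<⇒≯ rx<re)
    ... | no _      | yes _    = s≤s z≤n
    ... | no _      | no re≮ry = contradiction re<ry re≮ry

  block : ℕ → VSet n
  block j x = clean x ∧ (key x ≡ᵇ j)

  block⇒ : ∀ {j x} → block j x ≡ true → clean x ≡ true × key x ≡ j
  block⇒ {j} {x} bx = ∧-conicalˡ _ _ bx , ≡ᵇ-true (key x) j (∧-conicalʳ (clean x) _ bx)

  ⇒block : ∀ {x} → clean x ≡ true → block (key x) x ≡ true
  ⇒block {x} cx rewrite cx = T⇒≡true (≡⇒≡ᵇ (key x) (key x) refl)

  clean-or-dirty : ∀ w → w ∈ dirty ⊎ clean w ≡ true
  clean-or-dirty w with w ∈? dirty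
  ... | yes w∈ = inj₁ w∈
  ... | no _   = inj₂ refl

  -- No vertex outside a block is ranked strictly between two of its members:
  -- a dirty one would separate their keys, a clean one would have the same key.
  no-outsider-between : ∀ {j u v w} → block j u ≡ true → block j v ≡ true → block j w ≡ false →
                        r u < r w → r w < r v → ⊥
  no-outsider-between {j} {u} {v} {w} bu bv bw ru<rw rw<rv with clean-or-dirty w
  ... | inj₁ w∈ = <-irrefl (trans (proj₂ (block⇒ bu)) (sym (proj₂ (block⇒ bv)))) (key-mono-< w∈ ru<rw rw<rv)
  ... | inj₂ cw = contradiction (trans (sym bw) (subst (λ i → block i w ≡ true) key-w≡j (⇒block cw))) λ ()
    where
    key-w≡j : key w ≡ j
    key-w≡j = ≤-antisym (subst (key w ≤_) (proj₂ (block⇒ bv)) (key-mono (<⇒≤ rw<rv)))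
                        (subst (_≤ key w) (proj₂ (block⇒ bu)) (key-mono (<⇒≤ ru<rw)))

  same-side : ∀ {j u v w} → block j u ≡ true → block j v ≡ true → block j w ≡ false →
              r u < r w → r v < r w
  same-side {j} {u} {v} {w} bu bv bw ru<rw with r v <? r w
  ... | yes rv<rw = rv<rw
  ... | no rv≮rw  = contradiction (no-outsider-between bu bv bw ru<rw rw<rv) λ ()
    where
    rw<rv : r w < r v
    rw<rv = ≤∧≢⇒< (≮⇒≥ rv≮rw) (rank-distinct (proj₁ (block⇒ bv)) (outsider bv bw))
      where
      outsider : ∀ {x} → block j x ≡ true → block j w ≡ false → x ≢ w
      outsider bx bw refl = contradiction (trans (sym bx) bw) λ ()

  -- Each block is a module: an outsider w is an out-neighbour of a member u
  -- exactly when it is ranked above u, and this does not depend on u.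
  block-module : ∀ j → IsModule A (block j)
  block-module j u v w bu bv bw = ⇔→≡ {z = true} (mk⇔ (transfer bu bv) (transfer bv bu))
    where
    transfer : ∀ {x y} → block j x ≡ true → block j y ≡ true → A x w ≡ true → A y w ≡ true
    transfer bx by xw =
      rank⇒arc (proj₁ (block⇒ by)) (λ { refl → contradiction (trans (sym by) bw) λ () })
               (same-side bx by bw (arc-from-clean (proj₁ (block⇒ bx)) xw))

  -- Arcs inside a block go up in rank, so blocks are transitive modules.
  block-transitive : ∀ j → IsTransitiveModule A (block j)
  block-transitive j = block-module j , λ x x⁺x → <-irrefl refl (ranking-walk ranked x⁺x)
    where
    ranked : Ranking (λ u v → (block j u ≡ true) × (block j v ≡ true) × (A u v ≡ true))
    ranked = r , λ (bu , _ , uv) → arc-from-clean (proj₁ (block⇒ bu)) uv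

  closes : Fin n → Fin n × Fin n → Bool
  closes x (u , v) = A v x ∧ A x u

  load : Fin n → ℕ
  load x = ∑ F (ind ∘ closes x)

  _≟ᵃ_ : DecidableEquality (Fin n × Fin n)
  _≟ᵃ_ = ≡-dec _≟ᶠ_ _≟ᶠ_

  open DecMembership _≟ᵃ_ using () renaming (_∈?_ to _∈ᵃ?_)

  -- If a clean vertex x lies in M, every back arc u → v of M (u ∈ O, v ∈ I)
  -- forms the triangle x → u → v → x; since the arcs at x are ranked, u → v
  -- cannot be ranked as well, so it lies in F.
  back-arc∈F : ∀ {x} (M : VSet n) → clean x ≡ true → M x ≡ true → ∀ u v →
               (outSet A M u ∧ inSet A M v ∧ A u v) ≡ true → (⌊ (u , v) ∈ᵃ? F ⌋ ∧ closes x (u , v)) ≡ true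
  back-arc∈F {x} M cx Mx u v back = in-F ((u , v) ∈ᵃ? F)
    where
    xu : A x u ≡ true
    xu = outSet-arc A M (∧-conicalˡ _ _ back) Mx
    vx : A v x ≡ true
    vx = inSet-arc A M (∧-conicalˡ _ _ (∧-conicalʳ (outSet A M u) _ back)) Mx
    uv : A u v ≡ true
    uv = ∧-conicalʳ (inSet A M v) _ (∧-conicalʳ (outSet A M u) _ back)
    in-F : (uv∈F? : Dec ((u , v) ∈ F)) → (⌊ uv∈F? ⌋ ∧ closes x (u , v)) ≡ true
    in-F (yes _) rewrite vx | xu = refl
    in-F (no uv∉F) =
      contradiction (<-trans (<-trans (arc-from-clean cx xu) (r-mono uv uv∉F)) (arc-to-clean cx vx)) (<-irrefl refl)

  back-arcs≤load : ∀ {x} (M : VSet n) → clean x ≡ true → M x ≡ true → backArcCount A M ≤ load x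
  back-arcs≤load {x} M cx Mx = begin
    backArcCount A M
      ≤⟨ count-mono _ in-F-closing (λ { (u , v) → back-arc∈F M cx Mx u v }) pairs ⟩
    count in-F-closing pairs
      ≡⟨ count≡∑ in-F-closing pairs ⟩
    ∑ pairs (λ p → ind (⌊ p ∈ᵃ? F ⌋ ∧ closes x p))
      ≡⟨ ∑-cong (λ p → ind-∧ ⌊ p ∈ᵃ? F ⌋ (closes x p)) pairs ⟩
    ∑ pairs (λ p → ind ⌊ p ∈ᵃ? F ⌋ * ind (closes x p))
      ≤⟨ ∑-∈-≤ _≟ᵃ_ (ind ∘ closes x) pairs (cartesianProduct⁺ (allFin⁺ n) (allFin⁺ n)) F ⟩
    load x ∎
    where
    open ≤-Reasoning
    pairs : List (Fin n × Fin n)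
    pairs = cartesianProduct (allFin n) (allFin n)
    in-F-closing : Fin n × Fin n → Bool
    in-F-closing p = ⌊ p ∈ᵃ? F ⌋ ∧ closes x p

  -- Summing the loads counts every triangle through an arc of F once.
  ∑-load : ∀ k → ((u v : Fin n) → A u v ≡ true → trianglesOnArc A u v ≤ k) →
           (∀ {u v} → (u , v) ∈ F → A u v ≡ true) → ∑ (allFin n) load ≤ length F * k
  ∑-load k triangles≤k F⊆A = begin
    ∑ (allFin n) (λ x → ∑ F (ind ∘ closes x))
      ≡⟨ ∑-swap (λ x → ind ∘ closes x) (allFin n) F ⟩
    ∑ F (λ p → ∑ (allFin n) (λ x → ind (closes x p)))
      ≤⟨ ∑-mono-∈ F (λ { {u , v} uv∈F → subst (_≤ k) (count≡∑ (λ x → closes x (u , v)) (allFin n)) (triangles≤k u v (F⊆A uv∈F)) }) ⟩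
    ∑ F (λ _ → k)
      ≡⟨ ∑-const k F ⟩
    length F * k ∎
    where open ≤-Reasoning

  blocks : ℕ
  blocks = suc (length dirty)

  blockSize : ℕ → ℕ
  blockSize j = size (block j)

  ∑-by-blocks : ∀ g → ∑ (allFin n) (λ x → ind (clean x) * g (key x)) ≡ ∑ (downFrom blocks) (λ j → blockSize j * g j)
  ∑-by-blocks g = ∑-fibres clean key g blocks (allFin n) key<blocks

  cleanCount : ℕ
  cleanCount = size clean

  cleanCount≡∑blockSize : cleanCount ≡ ∑ (downFrom blocks) blockSize
  cleanCount≡∑blockSize = begin
    size clean                                             ≡⟨ count≡∑ clean (allFin n) ⟩
    ∑ (allFin n) (ind ∘ clean)                             ≡⟨ ∑-cong (λ x → sym (*-identityʳ (ind (clean x)))) (allFin n) ⟩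
    ∑ (allFin n) (λ x → ind (clean x) * 1)                 ≡⟨ ∑-by-blocks (λ _ → 1) ⟩
    ∑ (downFrom blocks) (λ j → blockSize j * 1)            ≡⟨ ∑-cong (λ j → *-identityʳ (blockSize j)) (downFrom blocks) ⟩
    ∑ (downFrom blocks) blockSize ∎
    where open ≡-Reasoning

  n≤dirty+clean : n ≤ length dirty + cleanCount
  n≤dirty+clean = begin
    n                                                       ≡⟨ sym (length-tabulate (λ x → x)) ⟩
    length (allFin n)                                       ≡⟨ sym (trans (∑-const 1 (allFin n)) (*-identityʳ _)) ⟩
    ∑ (allFin n) (λ _ → 1)                                  ≡⟨ ∑-cong (λ x → sym (ind-not ⌊ x ∈? dirty ⌋)) (allFin n) ⟩
    ∑ (allFin n) (λ x → ind ⌊ x ∈? dirty ⌋ + ind (clean x))  ≡⟨ ∑-+ _ _ (allFin n) ⟩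
    ∑ (allFin n) (λ x → ind ⌊ x ∈? dirty ⌋) + ∑ (allFin n) (ind ∘ clean)
      ≤⟨ +-mono-≤ dirty-count (≤-reflexive (sym (count≡∑ clean (allFin n)))) ⟩
    length dirty + cleanCount ∎
    where
    open ≤-Reasoning
    dirty-count : ∑ (allFin n) (λ x → ind ⌊ x ∈? dirty ⌋) ≤ length dirty
    dirty-count = begin
      ∑ (allFin n) (λ x → ind ⌊ x ∈? dirty ⌋)       ≡⟨ ∑-cong (λ x → sym (*-identityʳ _)) (allFin n) ⟩
      ∑ (allFin n) (λ x → ind ⌊ x ∈? dirty ⌋ * 1)   ≤⟨ ∑-∈-≤ _≟ᶠ_ (λ _ → 1) (allFin n) (allFin⁺ n) dirty ⟩
      ∑ dirty (λ _ → 1)                            ≡⟨ trans (∑-const 1 dirty) (*-identityʳ _) ⟩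
      length dirty ∎

  module _ (maximal-back-arcs : (M : VSet n) → IsMaximalTransitiveModule A M → backArcCount A M ≥ size M) where

    -- A maximal transitive module containing the block of a clean vertex x has at
    -- least as many back arcs as vertices, all of them counted by load x.
    blockSize≤load : ∀ {x} → clean x ≡ true → blockSize (key x) ≤ load x
    blockSize≤load {x} cx = decidable-stable (blockSize (key x) ≤? load x) do
      (M , maximal , block⊆M) ← maximal-extension (IsTransitiveModule A) (block (key x)) (block-transitive (key x))
      pure (≤-trans (size-mono block⊆M)
             (≤-trans (maximal-back-arcs M maximal) (back-arcs≤load M cx (block⊆M x (⇒block cx)))))

    ∑-blockSize² : ∀ k → ((u v : Fin n) → A u v ≡ true → trianglesOnArc A u v ≤ k) →
                   (∀ {u v} → (u , v) ∈ F → A u v ≡ true) →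
                   ∑ (downFrom blocks) (λ j → blockSize j * blockSize j) ≤ length F * k
    ∑-blockSize² k triangles≤k F⊆A = begin
      ∑ (downFrom blocks) (λ j → blockSize j * blockSize j)   ≡⟨ sym (∑-by-blocks blockSize) ⟩
      ∑ (allFin n) (λ x → ind (clean x) * blockSize (key x))  ≤⟨ ∑-mono clean-load (allFin n) ⟩
      ∑ (allFin n) load                                       ≤⟨ ∑-load k triangles≤k F⊆A ⟩
      length F * k ∎
      where
      open ≤-Reasoning
      clean-load : ∀ x → ind (clean x) * blockSize (key x) ≤ load x
      clean-load x with clean x in cx
      ... | true  = subst (_≤ load x) (sym (+-identityʳ _)) (blockSize≤load cx)
      ... | false = z≤n

    cleanCount² : ∀ k → ((u v : Fin n) → A u v ≡ true → trianglesOnArc A u v ≤ k) →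
                  (∀ {u v} → (u , v) ∈ F → A u v ≡ true) →
                  cleanCount * cleanCount ≤ blocks * (length F * k)
    cleanCount² k triangles≤k F⊆A = begin
      cleanCount * cleanCount
        ≡⟨ cong₂ _*_ cleanCount≡∑blockSize cleanCount≡∑blockSize ⟩
      ∑ (downFrom blocks) blockSize * ∑ (downFrom blocks) blockSize
        ≤⟨ cauchy-schwarz blockSize (downFrom blocks) ⟩
      length (downFrom blocks) * ∑ (downFrom blocks) (λ j → blockSize j * blockSize j)
        ≤⟨ *-mono-≤ (≤-reflexive (length-downFrom blocks)) (∑-blockSize² k triangles≤k F⊆A) ⟩
      blocks * (length F * k) ∎
      where open ≤-Reasoning

-- The final estimate: with f ≤ k arcs in F, 2f dirty vertices and c clean ones,
-- n ≤ 2k + c and c² ≤ (2k + 1)k² give n² ≤ 2(2k)² + 2c² ≤ 14k³.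
final-estimate : ∀ n c f k → 1 ≤ k → f ≤ k → n ≤ 2 * f + c → c * c ≤ suc (2 * f) * (f * k) →
                 n * n ≤ 14 * (k * k * k)
final-estimate n c f k 1≤k f≤k n≤ c²≤ = begin
  n * n                                          ≤⟨ *-mono-≤ n≤2k+c n≤2k+c ⟩
  (2 * k + c) * (2 * k + c)                      ≡⟨ square (2 * k) c ⟩
  2 * k * (2 * k) + c * c + 2 * (2 * k * c)      ≤⟨ +-monoʳ-≤ (2 * k * (2 * k) + c * c) (2ab≤a²+b² (2 * k) c) ⟩
  2 * k * (2 * k) + c * c + (2 * k * (2 * k) + c * c)
                                                 ≤⟨ +-mono-≤ (+-monoʳ-≤ (2 * k * (2 * k)) c²≤′) (+-monoʳ-≤ (2 * k * (2 * k)) c²≤′) ⟩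
  2 * k * (2 * k) + suc (2 * k) * (k * k) + (2 * k * (2 * k) + suc (2 * k) * (k * k))
                                                 ≡⟨ expand k ⟩
  4 * (k * k * k) + 10 * (k * k * 1)             ≤⟨ +-monoʳ-≤ (4 * (k * k * k)) (*-monoʳ-≤ 10 (*-monoʳ-≤ (k * k) 1≤k)) ⟩
  4 * (k * k * k) + 10 * (k * k * k)             ≡⟨ collect k ⟩
  14 * (k * k * k) ∎
  where
  open ≤-Reasoning
  n≤2k+c : n ≤ 2 * k + c
  n≤2k+c = ≤-trans n≤ (+-monoˡ-≤ c (*-monoʳ-≤ 2 f≤k))
  c²≤′ : c * c ≤ suc (2 * k) * (k * k)
  c²≤′ = ≤-trans c²≤ (*-mono-≤ (s≤s (*-monoʳ-≤ 2 f≤k)) (*-monoˡ-≤ k f≤k))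
  square : ∀ a b → (a + b) * (a + b) ≡ a * a + b * b + 2 * (a * b)
  square = solve-∀
  expand : ∀ k → 2 * k * (2 * k) + suc (2 * k) * (k * k) + (2 * k * (2 * k) + suc (2 * k) * (k * k))
                 ≡ 4 * (k * k * k) + 10 * (k * k * 1)
  expand = solve-∀
  collect : ∀ k → 4 * (k * k * k) + 10 * (k * k * k) ≡ 14 * (k * k * k)
  collect = solve-∀

theorem1 : ∃[ C ] ((n : ℕ) (A : Digraph n) (k : ℕ) →
             IsTournament A → k > 0 → HasFASAtMost A k →
             ((v : Fin n) → InTriangle A v) →
             ((u v : Fin n) → A u v ≡ true → trianglesOnArc A u v ≤ k) →
             ((M : VSet n) → IsMaximalTransitiveModule A M → backArcCount A M ≥ size M) →
             n * n ≤ C * (k * k * k))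
theorem1 = 14 , λ n A k tournament k>0 (F , (F⊆A , acyclic) , |F|≤k) _ triangles≤k maximal-back-arcs →
  decidable-stable (n * n ≤? 14 * (k * k * k)) $
    acyclic⇒ranking _ acyclic >>= λ (r , r-mono) →
      let open Blocks A tournament F r (λ xy xy∉F → r-mono (xy , xy∉F))
          |dirty|≡2|F| = length-endpoints F
      in pure (final-estimate n cleanCount (length F) k k>0 |F|≤k
                 (subst (λ d → n ≤ d + cleanCount) |dirty|≡2|F| n≤dirty+clean)
                 (subst (λ d → cleanCount * cleanCount ≤ suc d * (length F * k)) |dirty|≡2|F|
                   (cleanCount² maximal-back-arcs k triangles≤k (F⊆A _ _))))
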